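{- Let $n>2$. The lattice $(\mathfrak{C}(n)_\bot,\sqsubseteq)$ is not distributive, and is neither upper locally distributive nor lower locally distributive; it is not atomistic (hence not geometric); it is not modular, but it is upper semimodular.
   Context: Let $N=\{1,\dots,n\}$ and $\Pi(n)$ the lattice of partitions of $N$ ordered by refinement. An embedded subset is a pair $(S,\pi)$ with $S\subseteq N$ nonempty and $\pi\in\Pi(n)$ having $S$ as a block. $\mathfrak{C}(n)_\bot$ is the set of embedded subsets together with an added least element $\bot$, ordered by $(S,\pi)\sqsubseteq(S',\pi')$ iff $S\subseteq S'$ and $\pi$ refines $\pi'$. A finite lattice is upper locally distributive if for every element $x\neq$ top, the interval from $x$ to the join of the elements covering $x$ is a Boolean lattice; lower locally distributive is the dual notion. Atomistic means every element is a join of atoms. Upper semimodular means: if $x$ and $y$ both cover $x\wedge y$, then $x\vee y$ covers both $x$ and $y$. -}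

module Defs where

open import Data.Nat using (ℕ)
open import Data.Bool using (Bool; true; false)
open import Data.Fin using (Fin)
open import Data.Fin.Subset using (Subset; _∈_; _⊆_; Nonempty)
open import Data.Product using (Σ; ∃; _×_; _,_; proj₁)
open import Data.Sum using (_⊎_)
open import Data.Empty using (⊥)
open import Data.Unit using (⊤)
open import Data.List using (List)
open import Data.List.Relation.Unary.All using (All)
open import Relation.Nullary using (¬_)
open import Relation.Binary.PropositionalEquality using (_≡_)

module Order {A : Set} (_≤_ : A → A → Set) where

  _≈_ : A → A → Set
  x ≈ y = (x ≤ y) × (y ≤ x)

  _<_ : A → A → Set
  x < y = (x ≤ y) × ¬ (y ≤ x)

  _⋖_ : A → A → Set
  x ⋖ y = (x < y) × (∀ z → ¬ ((x < z) × (z < y)))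

  IsBottom : A → Set
  IsBottom b = ∀ y → b ≤ y

  IsTop : A → Set
  IsTop t = ∀ y → y ≤ t

  IsMeet : A → A → A → Set
  IsMeet x y m = (m ≤ x) × (m ≤ y) × (∀ z → z ≤ x → z ≤ y → z ≤ m)

  IsJoin : A → A → A → Set
  IsJoin x y j = (x ≤ j) × (y ≤ j) × (∀ z → x ≤ z → y ≤ z → j ≤ z)

  IsSup : (A → Set) → A → Set
  IsSup P j = (∀ y → P y → y ≤ j) × (∀ z → (∀ y → P y → y ≤ z) → j ≤ z)

  IsInf : (A → Set) → A → Set
  IsInf P m = (∀ y → P y → m ≤ y) × (∀ z → (∀ y → P y → z ≤ y) → z ≤ m)

  IsJoinOf : List A → A → Set
  IsJoinOf L j = All (_≤ j) L × (∀ z → All (_≤ z) L → j ≤ z)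

  IsLattice : Set
  IsLattice = ∀ x y → (∃ λ m → IsMeet x y m) × (∃ λ j → IsJoin x y j)

  Distributive : Set
  Distributive = ∀ x y z j m a b k →
    IsJoin y z j → IsMeet x j m → IsMeet x y a → IsMeet x z b →
    IsJoin a b k → m ≈ k

  Modular : Set
  Modular = ∀ x y z m l j r → x ≤ z →
    IsMeet y z m → IsJoin x m l → IsJoin x y j → IsMeet j z r → l ≈ r

  Complemented : Set
  Complemented = ∀ y → ∃ λ c → ∀ m j → IsMeet y c m → IsJoin y c j →
    IsBottom m × IsTop j

  IsBooleanLattice : Set
  IsBooleanLattice = IsLattice × (∃ IsBottom) × (∃ IsTop) ×
    Distributive × Complemented

  Atom : A → Set
  Atom a = ¬ IsBottom a × (∀ z → z < a → IsBottom z)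

  Atomistic : Set
  Atomistic = ∀ x → ∃ λ (L : List A) → All Atom L × IsJoinOf L x

  UpperSemimodular : Set
  UpperSemimodular = ∀ x y m j → IsMeet x y m → IsJoin x y j →
    m ⋖ x → m ⋖ y → (x ⋖ j) × (y ⋖ j)

  Geometric : Set
  Geometric = Atomistic × UpperSemimodular

Interval : {A : Set} (_≤_ : A → A → Set) → A → A → Set
Interval {A} _≤_ a b = Σ A (λ y → (a ≤ y) × (y ≤ b))

IntervalOrder : {A : Set} (_≤_ : A → A → Set) (a b : A) →
                Interval _≤_ a b → Interval _≤_ a b → Set
IntervalOrder _≤_ a b y z = proj₁ y ≤ proj₁ z

module LocalOrder {A : Set} (_≤_ : A → A → Set) where
  open Order _≤_

  IntervalBoolean : A → A → Set
  IntervalBoolean a b = Order.IsBooleanLattice (IntervalOrder _≤_ a b)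

  UpperLocallyDistributive : Set
  UpperLocallyDistributive = ∀ x j → ¬ IsTop x → IsSup (x ⋖_) j → IntervalBoolean x j

  LowerLocallyDistributive : Set
  LowerLocallyDistributive = ∀ x m → ¬ IsBottom x → IsInf (_⋖ x) m → IntervalBoolean m x

record Partition (n : ℕ) : Set where
  field
    rel   : Fin n → Fin n → Bool
    refl  : ∀ i → rel i i ≡ true
    sym   : ∀ i j → rel i j ≡ true → rel j i ≡ true
    trans : ∀ i j k → rel i j ≡ true → rel j k ≡ true → rel i k ≡ true
open Partition public

_≼_ : {n : ℕ} → Partition n → Partition n → Set
π ≼ π' = ∀ i j → rel π i j ≡ true → rel π' i j ≡ true

IsBlock : {n : ℕ} → Subset n → Partition n → Set
IsBlock S π = Nonempty S × (∀ i → i ∈ S → ∀ j → (j ∈ S → rel π i j ≡ true) × (rel π i j ≡ true → j ∈ S))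

data C⊥ (n : ℕ) : Set where
  bot : C⊥ n
  emb : (S : Subset n) (π : Partition n) → IsBlock S π → C⊥ n

_⊑_ : {n : ℕ} → C⊥ n → C⊥ n → Set
bot ⊑ _ = ⊤
emb S π _ ⊑ bot = ⊥
emb S π _ ⊑ emb S' π' _ = (S ⊆ S') × (π ≼ π')

-- Adjoin a new point ⋆ to N. Sending (S , π) to π with ⋆ added to the block S, and ⊥ to
-- the discrete partition, identifies 𝔠(n)_⊥ with the partitions of ⋆ ∪ N in which ⋆ is
-- not a singleton, together with the discrete one. Meets and joins are those of
-- partitions, followed by collapsing partitions with ⋆ isolated to ⊥. A cover merges
-- exactly two blocks, and merging the same two blocks into x gives the cover x ⋖ x ∨ y,
-- so the lattice is upper semimodular as the partition lattice is.
-- For n ≥ 3, {⋆0} < {⋆01} together with {⋆2}{01} form a pentagon, so the lattice is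
-- not modular and hence not distributive. Its atoms {⋆i} join to the top and its coatoms
-- meet to ⊥, so local distributivity at ⊥ or at the top would make [⊥ , ⊤] Boolean.
-- Finally the only atom below {⋆0}{12} is {⋆0}, so the lattice is not atomistic.

module Submission where

open import Defs hiding (refl; sym; trans)
open import Data.Bool using (Bool; true; false; _∧_; _∨_)
open import Data.Bool.Properties using () renaming (_≟_ to _≟ᵇ_)
open import Data.Empty using (⊥; ⊥-elim)
open import Data.Fin using (Fin; zero; suc)
open import Data.Fin.Properties using (_≟_; all?; any?; ¬∀⟶∃¬; suc-injective)
open import Data.Fin.Subset using (Subset; _∈_)
open import Data.List using (List; []; _∷_; filter; cartesianProduct; allFin)
open import Data.List.Membership.Propositional using () renaming (_∈_ to _∈ˡ_)
open import Data.List.Membership.Propositional.Properties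
  using (∈-filter⁺; ∈-cartesianProduct⁺; ∈-allFin)
open import Data.List.Relation.Unary.All as All using (All; []; _∷_)
open import Data.List.Relation.Unary.All.Properties using (all-filter)
open import Data.List.Relation.Unary.Any using (here; there)
open import Data.Nat using (ℕ; suc; _<_; s≤s)
open import Data.Product using (_×_; _,_; proj₁; proj₂; ∃; ∃₂)
open import Data.Sum using (_⊎_; inj₁; inj₂; [_,_]′)
open import Data.Unit using (tt)
open import Data.Unit.Properties using () renaming (_≟_ to _≟ᵘ_)
open import Data.Vec using (lookup; tabulate)
open import Data.Vec.Properties using (lookup∘tabulate; []=⇒lookup; lookup⇒[]=)
open import Function using (id; const; _∘_)
open import Relation.Binary.Definitions using (DecidableEquality)
open import Relation.Binary.PropositionalEquality
  using (_≡_; _≢_; refl; sym; trans; subst)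
open import Relation.Nullary using (¬_; Dec; yes; no; does)
open import Relation.Nullary.Decidable
  using (dec-true; dec-false; map′; _→-dec_; decidable-stable)
open import Relation.Nullary.Negation using (contradiction)
open import Relation.Unary using (Decidable)

dec-true⁻¹ : {A : Set} (a? : Dec A) → does a? ≡ true → A
dec-true⁻¹ (yes a) _ = a

∧-true⁺ : ∀ {a b} → a ≡ true → b ≡ true → a ∧ b ≡ true
∧-true⁺ refl b = b

∧-true⁻ : ∀ a {b} → a ∧ b ≡ true → a ≡ true × b ≡ true
∧-true⁻ true b = refl , b

∨-true⁺ : ∀ a {b} → a ≡ true ⊎ b ≡ true → a ∨ b ≡ true
∨-true⁺ true  _        = refl
∨-true⁺ false (inj₁ ())
∨-true⁺ false (inj₂ b) = b

∨-true⁻ : ∀ a {b} → a ∨ b ≡ true → a ≡ true ⊎ b ≡ true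
∨-true⁻ true  _ = inj₁ refl
∨-true⁻ false b = inj₂ b

module _ {m : ℕ} where

  infix 4 _∼[_]_ _⊴_

  _∼[_]_ : Fin m → Partition m → Fin m → Set
  i ∼[ R ] j = rel R i j ≡ true

  ∼-refl : (R : Partition m) {i : Fin m} → i ∼[ R ] i
  ∼-refl R = Partition.refl R _

  ∼-sym : (R : Partition m) {i j : Fin m} → i ∼[ R ] j → j ∼[ R ] i
  ∼-sym R = Partition.sym R _ _

  ∼-trans : (R : Partition m) {i j k : Fin m} → i ∼[ R ] j → j ∼[ R ] k → i ∼[ R ] k
  ∼-trans R = Partition.trans R _ _ _

  record _⊴_ (R S : Partition m) : Set where
    constructor mk⊴
    field coarsen : ∀ {i j} → i ∼[ R ] j → i ∼[ S ] j
  open _⊴_ public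

  ⊴-refl : {R : Partition m} → R ⊴ R
  ⊴-refl = mk⊴ id

  ⊴-trans : {R S T : Partition m} → R ⊴ S → S ⊴ T → R ⊴ T
  ⊴-trans R⊴S S⊴T = mk⊴ λ p → coarsen S⊴T (coarsen R⊴S p)

  private
    step? : (R S : Partition m) (i j : Fin m) → Dec (i ∼[ R ] j → i ∼[ S ] j)
    step? R S i j = (rel R i j ≟ᵇ true) →-dec (rel S i j ≟ᵇ true)

  _⊴?_ : (R S : Partition m) → Dec (R ⊴ S)
  R ⊴? S = map′ (λ f → mk⊴ (f _ _)) (λ R⊴S i j → coarsen R⊴S)
    (all? λ i → all? (step? R S i))

  ⋬⇒separating-pair : {R S : Partition m} → ¬ R ⊴ S →
                      ∃₂ λ i j → i ∼[ R ] j × ¬ i ∼[ S ] j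
  ⋬⇒separating-pair {R} {S} R⋬S
    with ¬∀⟶∃¬ m _ (λ i → all? (step? R S i)) (λ f → R⋬S (mk⊴ (f _ _)))
  ... | i , ¬∀j with ¬∀⟶∃¬ m _ (step? R S i) ¬∀j
  ... | j , ¬i→j with rel R i j ≟ᵇ true
  ...   | yes i∼j = i , j , i∼j , λ i∼′j → ¬i→j (const i∼′j)
  ...   | no i≁j  = contradiction (λ i∼j → contradiction i∼j i≁j) ¬i→j

  kernel : {A : Set} → DecidableEquality A → (Fin m → A) → Partition m
  kernel _≟ᴬ_ f = record
    { rel   = λ i j → does (f i ≟ᴬ f j)
    ; refl  = λ i → dec-true (f i ≟ᴬ f i) refl
    ; sym   = λ i j p → dec-true (f j ≟ᴬ f i) (sym (dec-true⁻¹ (f i ≟ᴬ f j) p))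
    ; trans = λ i j k p q → dec-true (f i ≟ᴬ f k)
                (trans (dec-true⁻¹ (f i ≟ᴬ f j) p) (dec-true⁻¹ (f j ≟ᴬ f k) q))
    }

  kernel⁻ : {A : Set} (_≟ᴬ_ : DecidableEquality A) (f : Fin m → A) {i j : Fin m} →
            i ∼[ kernel _≟ᴬ_ f ] j → f i ≡ f j
  kernel⁻ _≟ᴬ_ f {i} {j} = dec-true⁻¹ (f i ≟ᴬ f j)

  kernel⁺ : {A : Set} (_≟ᴬ_ : DecidableEquality A) (f : Fin m → A) {i j : Fin m} →
            f i ≡ f j → i ∼[ kernel _≟ᴬ_ f ] j
  kernel⁺ _≟ᴬ_ f {i} {j} = dec-true (f i ≟ᴬ f j)

  discrete : Partition m
  discrete = kernel _≟_ id

  discrete-least : {R : Partition m} → discrete ⊴ R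
  discrete-least {R} = mk⊴ λ {i} p → subst (i ∼[ R ]_) (kernel⁻ _≟_ id p) (∼-refl R)

  indiscrete : Partition m
  indiscrete = kernel _≟ᵘ_ (const tt)

  indiscrete-greatest : {R : Partition m} → R ⊴ indiscrete
  indiscrete-greatest = mk⊴ λ _ → refl

  indiscrete-least : {R : Partition m} (a : Fin m) → (∀ j → a ∼[ R ] j) → indiscrete ⊴ R
  indiscrete-least {R} a a∼ = mk⊴ λ {i} {j} _ → ∼-trans R (∼-sym R (a∼ i)) (a∼ j)

  private
    _≡ᵇ_ : Fin m → Fin m → Bool
    p ≡ᵇ c = does (p ≟ c)

  isolate : Fin m → Partition m
  isolate c = kernel _≟ᵇ_ (_≡ᵇ c)

  isolate-∼ : {a c q : Fin m} → a ≢ c → q ≢ c → a ∼[ isolate c ] q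
  isolate-∼ {a} {c} {q} a≢c q≢c =
    kernel⁺ _≟ᵇ_ (_≡ᵇ c) {a} {q} (trans (dec-false (a ≟ c) a≢c) (sym (dec-false (q ≟ c) q≢c)))

  isolate-≁ : {a c : Fin m} → a ≢ c → ¬ a ∼[ isolate c ] c
  isolate-≁ {a} {c} a≢c a∼c = a≢c (dec-true⁻¹ (a ≟ c)
    (trans (kernel⁻ _≟ᵇ_ (_≡ᵇ c) {a} {c} a∼c) (dec-true (c ≟ c) refl)))

  -- isolate c is a coatom of the partition lattice
  isolate-or-indiscrete : {R : Partition m} {a c : Fin m} → (∀ q → q ≢ c → a ∼[ R ] q) →
                          indiscrete ⊴ R ⊎ R ⊴ isolate c
  isolate-or-indiscrete {R} {a} {c} a∼ with rel R a c ≟ᵇ true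
  ... | yes a∼c = inj₁ (indiscrete-least a λ q → with-c q (q ≟ c))
    where
    with-c : ∀ q → Dec (q ≡ c) → a ∼[ R ] q
    with-c q (yes refl) = a∼c
    with-c q (no q≢c)   = a∼ q q≢c
  ... | no a≁c = inj₂ (mk⊴ λ {p} {q} p∼q → kernel⁺ _≟ᵇ_ (_≡ᵇ c) {p} {q} (same-side p q p∼q))
    where
    same-side : ∀ p q → p ∼[ R ] q → does (p ≟ c) ≡ does (q ≟ c)
    same-side p q p∼q with p ≟ c | q ≟ c
    ... | yes _    | yes _    = refl
    ... | no _     | no _     = refl
    ... | yes refl | no q≢c  = contradiction (∼-trans R (a∼ q q≢c) (∼-sym R p∼q)) a≁c
    ... | no p≢c  | yes refl = contradiction (∼-trans R (a∼ p p≢c) p∼q) a≁c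

  infixr 7 _∧ₚ_

  _∧ₚ_ : Partition m → Partition m → Partition m
  R ∧ₚ S = record
    { rel   = λ i j → rel R i j ∧ rel S i j
    ; refl  = λ i → ∧-true⁺ (∼-refl R) (∼-refl S)
    ; sym   = λ i j p → let (r , s) = ∧-true⁻ (rel R i j) p in ∧-true⁺ (∼-sym R r) (∼-sym S s)
    ; trans = λ i j k p q → let (r , s) = ∧-true⁻ (rel R i j) p
                                (r′ , s′) = ∧-true⁻ (rel R j k) q
                            in ∧-true⁺ (∼-trans R r r′) (∼-trans S s s′)
    }

  ∧ₚ-lowerˡ : {R S : Partition m} → R ∧ₚ S ⊴ R
  ∧ₚ-lowerˡ {R} = mk⊴ λ {i} {j} p → proj₁ (∧-true⁻ (rel R i j) p)

  ∧ₚ-lowerʳ : {R S : Partition m} → R ∧ₚ S ⊴ S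
  ∧ₚ-lowerʳ {R} = mk⊴ λ {i} {j} p → proj₂ (∧-true⁻ (rel R i j) p)

  ∧ₚ-greatest : {R S T : Partition m} → T ⊴ R → T ⊴ S → T ⊴ R ∧ₚ S
  ∧ₚ-greatest T⊴R T⊴S = mk⊴ λ p → ∧-true⁺ (coarsen T⊴R p) (coarsen T⊴S p)

  module _ (R : Partition m) (a b : Fin m) where

    data Merged (p q : Fin m) : Set where
      old  : p ∼[ R ] q → Merged p q
      a→b : p ∼[ R ] a → b ∼[ R ] q → Merged p q
      b→a : p ∼[ R ] b → a ∼[ R ] q → Merged p q

    merged? : Fin m → Fin m → Bool
    merged? p q = rel R p q ∨ (rel R p a ∧ rel R b q) ∨ (rel R p b ∧ rel R a q)

    merged⁺ : ∀ {p q} → Merged p q → merged? p q ≡ true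
    merged⁺ {p} {q} (old r)   = ∨-true⁺ (rel R p q) (inj₁ r)
    merged⁺ {p} {q} (a→b r s) =
      ∨-true⁺ (rel R p q) (inj₂ (∨-true⁺ (rel R p a ∧ rel R b q) (inj₁ (∧-true⁺ r s))))
    merged⁺ {p} {q} (b→a r s) =
      ∨-true⁺ (rel R p q) (inj₂ (∨-true⁺ (rel R p a ∧ rel R b q) (inj₂ (∧-true⁺ r s))))

    merged⁻ : ∀ {p q} → merged? p q ≡ true → Merged p q
    merged⁻ {p} {q} h with ∨-true⁻ (rel R p q) h
    ... | inj₁ r = old r
    ... | inj₂ h′ with ∨-true⁻ (rel R p a ∧ rel R b q) h′
    ...   | inj₁ rs = let (r , s) = ∧-true⁻ (rel R p a) rs in a→b r s
    ...   | inj₂ rs = let (r , s) = ∧-true⁻ (rel R p b) rs in b→a r s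

    Merged-sym : ∀ {p q} → Merged p q → Merged q p
    Merged-sym (old r)   = old (∼-sym R r)
    Merged-sym (a→b r s) = b→a (∼-sym R s) (∼-sym R r)
    Merged-sym (b→a r s) = a→b (∼-sym R s) (∼-sym R r)

    Merged-trans : ∀ {p q s} → Merged p q → Merged q s → Merged p s
    Merged-trans (old r)   (old r′)   = old (∼-trans R r r′)
    Merged-trans (old r)   (a→b r′ s) = a→b (∼-trans R r r′) s
    Merged-trans (old r)   (b→a r′ s) = b→a (∼-trans R r r′) s
    Merged-trans (a→b r s) (old r′)   = a→b r (∼-trans R s r′)
    Merged-trans (a→b r _) (a→b _ s)  = a→b r s
    Merged-trans (a→b r _) (b→a _ s)  = old (∼-trans R r s)
    Merged-trans (b→a r s) (old r′)   = b→a r (∼-trans R s r′)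
    Merged-trans (b→a r _) (a→b _ s)  = old (∼-trans R r s)
    Merged-trans (b→a r _) (b→a _ s)  = b→a r s

  merge : Partition m → Fin m → Fin m → Partition m
  merge R a b = record
    { rel   = merged? R a b
    ; refl  = λ i → merged⁺ R a b (old (∼-refl R))
    ; sym   = λ i j p → merged⁺ R a b (Merged-sym R a b (merged⁻ R a b p))
    ; trans = λ i j k p q → merged⁺ R a b (Merged-trans R a b (merged⁻ R a b p) (merged⁻ R a b q))
    }

  merge-upper : {R : Partition m} {a b : Fin m} → R ⊴ merge R a b
  merge-upper {R} {a} {b} = mk⊴ λ r → merged⁺ R a b (old r)

  merge-relates : {R : Partition m} {a b : Fin m} → a ∼[ merge R a b ] b
  merge-relates {R} {a} {b} = merged⁺ R a b (a→b (∼-refl R) (∼-refl R))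

  merge-least : {R W : Partition m} {a b : Fin m} → R ⊴ W → a ∼[ W ] b → merge R a b ⊴ W
  merge-least {R} {W} {a} {b} R⊴W a∼b = mk⊴ λ p → from (merged⁻ R a b p)
    where
    from : ∀ {p q} → Merged R a b p q → p ∼[ W ] q
    from (old r)   = coarsen R⊴W r
    from (a→b r s) = ∼-trans W (coarsen R⊴W r) (∼-trans W a∼b (coarsen R⊴W s))
    from (b→a r s) = ∼-trans W (coarsen R⊴W r) (∼-trans W (∼-sym W a∼b) (coarsen R⊴W s))

  merge-mono : {R S : Partition m} {a b : Fin m} → R ⊴ S → merge R a b ⊴ merge S a b
  merge-mono {S = S} {a} {b} R⊴S =
    merge-least (⊴-trans R⊴S (merge-upper {S} {a} {b})) (merge-relates {S} {a} {b})

  merge-new-pair : {R Z : Partition m} {a b p q : Fin m} → R ⊴ Z →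
                   p ∼[ merge R a b ] q → ¬ p ∼[ R ] q → p ∼[ Z ] q → a ∼[ Z ] b
  merge-new-pair {R} {Z} {a} {b} R⊴Z p∼q p≁q p∼′q with merged⁻ R a b p∼q
  ... | old r   = contradiction r p≁q
  ... | a→b r s = ∼-trans Z (∼-sym Z (coarsen R⊴Z r)) (∼-trans Z p∼′q (∼-sym Z (coarsen R⊴Z s)))
  ... | b→a r s = ∼-trans Z (coarsen R⊴Z s) (∼-trans Z (∼-sym Z p∼′q) (coarsen R⊴Z r))

  mergeAll : Partition m → List (Fin m × Fin m) → Partition m
  mergeAll R []             = R
  mergeAll R ((a , b) ∷ ps) = merge (mergeAll R ps) a b

  mergeAll-upper : {R : Partition m} (ps : List (Fin m × Fin m)) → R ⊴ mergeAll R ps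
  mergeAll-upper []             = ⊴-refl
  mergeAll-upper ((a , b) ∷ ps) = ⊴-trans (mergeAll-upper ps) merge-upper

  mergeAll-relates : {R : Partition m} {a b : Fin m} {ps : List (Fin m × Fin m)} →
                     (a , b) ∈ˡ ps → a ∼[ mergeAll R ps ] b
  mergeAll-relates {R} {ps = _ ∷ ps} (here refl) = merge-relates {mergeAll R ps}
  mergeAll-relates {R} {ps = (c , d) ∷ ps} (there e) =
    coarsen (merge-upper {mergeAll R ps} {c} {d}) (mergeAll-relates e)

  Edge : Partition m → Fin m × Fin m → Set
  Edge W (a , b) = a ∼[ W ] b

  mergeAll-least : {R W : Partition m} {ps : List (Fin m × Fin m)} →
                   R ⊴ W → All (Edge W) ps → mergeAll R ps ⊴ W
  mergeAll-least R⊴W []               = R⊴W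
  mergeAll-least R⊴W (a∼b ∷ a∼bs) = merge-least (mergeAll-least R⊴W a∼bs) a∼b

  edge? : (S : Partition m) → Decidable (Edge S)
  edge? S (a , b) = rel S a b ≟ᵇ true

  infixr 6 _∨ₚ_

  allPairs : List (Fin m × Fin m)
  allPairs = cartesianProduct (allFin m) (allFin m)

  _∨ₚ_ : Partition m → Partition m → Partition m
  R ∨ₚ S = mergeAll R (filter (edge? S) allPairs)

  ∨ₚ-upperˡ : {R S : Partition m} → R ⊴ R ∨ₚ S
  ∨ₚ-upperˡ {S = S} = mergeAll-upper (filter (edge? S) allPairs)

  ∨ₚ-upperʳ : {R S : Partition m} → S ⊴ R ∨ₚ S
  ∨ₚ-upperʳ {S = S} = mk⊴ λ {a} {b} a∼b →
    mergeAll-relates (∈-filter⁺ (edge? S) (∈-cartesianProduct⁺ (∈-allFin a) (∈-allFin b)) a∼b)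

  ∨ₚ-least : {R S W : Partition m} → R ⊴ W → S ⊴ W → R ∨ₚ S ⊴ W
  ∨ₚ-least {S = S} R⊴W S⊴W = mergeAll-least R⊴W
    (All.map (λ {(a , b)} → coarsen S⊴W) (all-filter (edge? S) allPairs))

module _ {A : Set} {_≤_ : A → A → Set} where
  open Order _≤_
  open LocalOrder _≤_

  ⋖-respʳ-≈ : (≤-trans : ∀ {x y z} → x ≤ y → y ≤ z → x ≤ z) →
              ∀ {x y z} → x ⋖ y → y ≈ z → x ⋖ z
  ⋖-respʳ-≈ ≤-trans ((x≤y , y≰x) , between) (y≤z , z≤y) =
    (≤-trans x≤y y≤z , λ z≤x → y≰x (≤-trans y≤z z≤x)) ,
    λ w ((x≤w , w≰x) , (w≤z , z≰w)) →
      between w ((x≤w , w≰x) , (≤-trans w≤z z≤y , λ y≤w → z≰w (≤-trans z≤y y≤w)))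

  distributive⇒modular : (≤-refl : ∀ {x} → x ≤ x) → Distributive → Modular
  distributive⇒modular ≤-refl D x y z m l j r x≤z (m≤y , m≤z , m-glb) x∨m x∨y (r≤j , r≤z , r-glb) =
    let (r≤l , l≤r) = D z x y j r x m l x∨y
                        (r≤z , r≤j , λ w w≤z w≤j → r-glb w w≤j w≤z)
                        (x≤z , ≤-refl , λ w _ w≤x → w≤x)
                        (m≤z , m≤y , λ w w≤z w≤y → m-glb w w≤y w≤z) x∨m
    in l≤r , r≤l

  interval-distributive : ∀ {b t} → IsBottom b → IsTop t →
    Order.Distributive (IntervalOrder _≤_ b t) → Distributive
  interval-distributive {b} {t} b≤ ≤t D x y z j m a c k y∨z x∧j x∧y x∧z a∨c =
    D (ι x) (ι y) (ι z) (ι j) (ι m) (ι a) (ι c) (ι k)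
      (join y∨z) (meet x∧j) (meet x∧y) (meet x∧z) (join a∨c)
    where
    ι : A → Interval _≤_ b t
    ι x = x , b≤ x , ≤t x
    join : ∀ {x y j} → IsJoin x y j → Order.IsJoin (IntervalOrder _≤_ b t) (ι x) (ι y) (ι j)
    join (x≤j , y≤j , least) = x≤j , y≤j , λ w → least (proj₁ w)
    meet : ∀ {x y m} → IsMeet x y m → Order.IsMeet (IntervalOrder _≤_ b t) (ι x) (ι y) (ι m)
    meet (m≤x , m≤y , greatest) = m≤x , m≤y , λ w → greatest (proj₁ w)

  upperLocallyDistributive⇒distributive : UpperLocallyDistributive →
    ∀ {b t} → IsBottom b → ¬ IsTop b → IsTop t → IsSup (b ⋖_) t → Distributive
  upperLocallyDistributive⇒distributive U b≤ b-not-top ≤t sup =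
    let (_ , _ , _ , D , _) = U _ _ b-not-top sup in interval-distributive b≤ ≤t D

  lowerLocallyDistributive⇒distributive : LowerLocallyDistributive →
    ∀ {b t} → IsBottom b → IsTop t → ¬ IsBottom t → IsInf (_⋖ t) b → Distributive
  lowerLocallyDistributive⇒distributive L b≤ ≤t t-not-bottom inf =
    let (_ , _ , _ , D , _) = L _ _ t-not-bottom inf in interval-distributive b≤ ≤t D

-- The added point of ⋆ ∪ N is zero : Fin (suc n); the points of N are suc i.
pattern ⋆ = zero

module _ {n : ℕ} where

  ∈⇒lookup : {S : Subset n} {i : Fin n} → i ∈ S → lookup S i ≡ true
  ∈⇒lookup = []=⇒lookup

  lookup⇒∈ : {S : Subset n} {i : Fin n} → lookup S i ≡ true → i ∈ S
  lookup⇒∈ {S} {i} = lookup⇒[]= i S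

  module _ (S : Subset n) (π : Partition n) (S-block : IsBlock S π) where

    private
      ∈-∼ : ∀ {i j} → lookup S i ≡ true → lookup S j ≡ true → i ∼[ π ] j
      ∈-∼ i∈S j∈S = proj₁ (proj₂ S-block _ (lookup⇒∈ i∈S) _) (lookup⇒∈ j∈S)

      ∼-∈ : ∀ {i j} → lookup S i ≡ true → i ∼[ π ] j → lookup S j ≡ true
      ∼-∈ i∈S i∼j = ∈⇒lookup (proj₂ (proj₂ S-block _ (lookup⇒∈ i∈S) _) i∼j)

    with⋆? : Fin (suc n) → Fin (suc n) → Bool
    with⋆? ⋆       ⋆       = true
    with⋆? ⋆       (suc j) = lookup S j
    with⋆? (suc i) ⋆       = lookup S i
    with⋆? (suc i) (suc j) = rel π i j

    with⋆-refl : ∀ i → with⋆? i i ≡ true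
    with⋆-refl ⋆       = refl
    with⋆-refl (suc i) = ∼-refl π

    with⋆-sym : ∀ i j → with⋆? i j ≡ true → with⋆? j i ≡ true
    with⋆-sym ⋆       ⋆       p = p
    with⋆-sym ⋆       (suc j) p = p
    with⋆-sym (suc i) ⋆       p = p
    with⋆-sym (suc i) (suc j) p = ∼-sym π p

    with⋆-trans : ∀ i j k → with⋆? i j ≡ true → with⋆? j k ≡ true → with⋆? i k ≡ true
    with⋆-trans ⋆       ⋆       k       p q = q
    with⋆-trans ⋆       (suc j) ⋆       p q = refl
    with⋆-trans ⋆       (suc j) (suc k) p q = ∼-∈ p q
    with⋆-trans (suc i) ⋆       ⋆       p q = p
    with⋆-trans (suc i) ⋆       (suc k) p q = ∈-∼ p q
    with⋆-trans (suc i) (suc j) ⋆       p q = ∼-∈ q (∼-sym π p)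
    with⋆-trans (suc i) (suc j) (suc k) p q = ∼-trans π p q

    with⋆ : Partition (suc n)
    with⋆ = record { rel = with⋆? ; refl = with⋆-refl ; sym = with⋆-sym ; trans = with⋆-trans }

  ⟦_⟧ : C⊥ n → Partition (suc n)
  ⟦ bot ⟧       = discrete
  ⟦ emb S π h ⟧ = with⋆ S π h

  ⊑⇒⊴ : {x y : C⊥ n} → x ⊑ y → ⟦ x ⟧ ⊴ ⟦ y ⟧
  ⊑⇒⊴ {bot}                         _            = discrete-least
  ⊑⇒⊴ {emb S π h} {emb S′ π′ h′} (S⊆S′ , π≼π′) = mk⊴ λ {i} {j} → go i j
    where
    go : ∀ i j → with⋆? S π h i j ≡ true → with⋆? S′ π′ h′ i j ≡ true
    go ⋆       ⋆       p = refl
    go ⋆       (suc j) p = ∈⇒lookup (S⊆S′ (lookup⇒∈ p))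
    go (suc i) ⋆       p = ∈⇒lookup (S⊆S′ (lookup⇒∈ p))
    go (suc i) (suc j) p = π≼π′ i j p

  Linked⋆ : Partition (suc n) → Set
  Linked⋆ R = ∃ λ k → ⋆ ∼[ R ] suc k

  linked⋆? : (R : Partition (suc n)) → Dec (Linked⋆ R)
  linked⋆? R = any? λ k → rel R ⋆ (suc k) ≟ᵇ true

  ⟦emb⟧-linked : ∀ S π h → Linked⋆ ⟦ emb S π h ⟧
  ⟦emb⟧-linked S π ((k , k∈S) , _) = k , ∈⇒lookup k∈S

  ⊴⇒⊑ : {x y : C⊥ n} → ⟦ x ⟧ ⊴ ⟦ y ⟧ → x ⊑ y
  ⊴⇒⊑ {bot}                        _   = tt
  ⊴⇒⊑ {emb S π h} {bot}        x⊴y =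
    let (k , ⋆∼k) = ⟦emb⟧-linked S π h in contradiction (coarsen x⊴y {⋆} {suc k} ⋆∼k) λ ()
  ⊴⇒⊑ {emb S π h} {emb S′ π′ h′} x⊴y =
    (λ {i} i∈S → lookup⇒∈ (coarsen x⊴y {⋆} {suc i} (∈⇒lookup i∈S))) ,
    (λ i j → coarsen x⊴y {suc i} {suc j})

  ⊑-refl : {x : C⊥ n} → x ⊑ x
  ⊑-refl = ⊴⇒⊑ ⊴-refl

  ⊑-trans : {x y z : C⊥ n} → x ⊑ y → y ⊑ z → x ⊑ z
  ⊑-trans x⊑y y⊑z = ⊴⇒⊑ (⊴-trans (⊑⇒⊴ x⊑y) (⊑⇒⊴ y⊑z))

  _⊑?_ : (x y : C⊥ n) → Dec (x ⊑ y)
  x ⊑? y = map′ ⊴⇒⊑ ⊑⇒⊴ (⟦ x ⟧ ⊴? ⟦ y ⟧)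

  ⊑-stable : {x y : C⊥ n} → ¬ ¬ x ⊑ y → x ⊑ y
  ⊑-stable {x} {y} = decidable-stable (x ⊑? y)

  module _ (R : Partition (suc n)) where

    ⋆-block : Subset n
    ⋆-block = tabulate λ i → rel R ⋆ (suc i)

    restrict : Partition n
    restrict = record
      { rel   = λ i j → rel R (suc i) (suc j)
      ; refl  = λ i → ∼-refl R
      ; sym   = λ i j → ∼-sym R
      ; trans = λ i j k → ∼-trans R
      }

    private
      ∈⋆-block : ∀ {i} → i ∈ ⋆-block → ⋆ ∼[ R ] suc i
      ∈⋆-block {i} i∈ = trans (sym (lookup∘tabulate _ i)) (∈⇒lookup i∈)

      ∈⋆-block⁺ : ∀ {i} → ⋆ ∼[ R ] suc i → i ∈ ⋆-block
      ∈⋆-block⁺ {i} ⋆∼i = lookup⇒∈ (trans (lookup∘tabulate _ i) ⋆∼i)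

    ⋆-block-isBlock : Linked⋆ R → IsBlock ⋆-block restrict
    ⋆-block-isBlock (k , ⋆∼k) = (k , ∈⋆-block⁺ ⋆∼k) , λ i i∈ j →
      (λ j∈ → ∼-trans R (∼-sym R (∈⋆-block i∈)) (∈⋆-block j∈)) ,
      (λ i∼j → ∈⋆-block⁺ (∼-trans R (∈⋆-block i∈) i∼j))

    decode : Linked⋆ R → C⊥ n
    decode l = emb ⋆-block restrict (⋆-block-isBlock l)

    ⟦decode⟧⊴ : (l : Linked⋆ R) → ⟦ decode l ⟧ ⊴ R
    ⟦decode⟧⊴ l = mk⊴ λ {i} {j} → go i j
      where
      go : ∀ i j → with⋆? ⋆-block restrict (⋆-block-isBlock l) i j ≡ true → i ∼[ R ] j
      go ⋆       ⋆       p = ∼-refl R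
      go ⋆       (suc j) p = trans (sym (lookup∘tabulate _ j)) p
      go (suc i) ⋆       p = ∼-sym R (trans (sym (lookup∘tabulate _ i)) p)
      go (suc i) (suc j) p = p

    ⊴⟦decode⟧ : (l : Linked⋆ R) → R ⊴ ⟦ decode l ⟧
    ⊴⟦decode⟧ l = mk⊴ λ {i} {j} → go i j
      where
      go : ∀ i j → i ∼[ R ] j → with⋆? ⋆-block restrict (⋆-block-isBlock l) i j ≡ true
      go ⋆       ⋆       p = refl
      go ⋆       (suc j) p = trans (lookup∘tabulate _ j) p
      go (suc i) ⋆       p = trans (lookup∘tabulate _ i) (∼-sym R p)
      go (suc i) (suc j) p = p

  -- ⌊_⌋ is right adjoint to ⟦_⟧, and inverse to it on linked partitions
  ⌊_⌋ : Partition (suc n) → C⊥ n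
  ⌊ R ⌋ with linked⋆? R
  ... | yes l = decode R l
  ... | no _  = bot

  ⟦⌊⌋⟧⊴ : (R : Partition (suc n)) → ⟦ ⌊ R ⌋ ⟧ ⊴ R
  ⟦⌊⌋⟧⊴ R with linked⋆? R
  ... | yes l = ⟦decode⟧⊴ R l
  ... | no _  = discrete-least

  ⊴⟦⌊⌋⟧ : {R : Partition (suc n)} → Linked⋆ R → R ⊴ ⟦ ⌊ R ⌋ ⟧
  ⊴⟦⌊⌋⟧ {R} l with linked⋆? R
  ... | yes l′ = ⊴⟦decode⟧ R l′
  ... | no ¬l  = contradiction l ¬l

  ⌊⌋-upper : {z : C⊥ n} {R : Partition (suc n)} → ⟦ z ⟧ ⊴ R → z ⊑ ⌊ R ⌋
  ⌊⌋-upper {bot}                 _   = tt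
  ⌊⌋-upper {emb S π h} {R} z⊴R =
    let (k , ⋆∼k) = ⟦emb⟧-linked S π h in ⊴⇒⊑ (⊴-trans z⊴R (⊴⟦⌊⌋⟧ (k , coarsen z⊴R ⋆∼k)))

  ⌊⌋-lower : {z : C⊥ n} {R : Partition (suc n)} → R ⊴ ⟦ z ⟧ → ⌊ R ⌋ ⊑ z
  ⌊⌋-lower {R = R} R⊴z = ⊴⇒⊑ (⊴-trans (⟦⌊⌋⟧⊴ R) R⊴z)

module _ {n : ℕ} where
  open Order (_⊑_ {n}) renaming (_<_ to _⊏_)

  infixr 27 _⊓_
  infixr 26 _⊔_

  _⊓_ : C⊥ n → C⊥ n → C⊥ n
  x ⊓ y = ⌊ ⟦ x ⟧ ∧ₚ ⟦ y ⟧ ⌋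

  _⊔_ : C⊥ n → C⊥ n → C⊥ n
  x ⊔ y = ⌊ ⟦ x ⟧ ∨ₚ ⟦ y ⟧ ⌋

  ⊓-isMeet : ∀ x y → IsMeet x y (x ⊓ y)
  ⊓-isMeet x y = ⌊⌋-lower (∧ₚ-lowerˡ {S = ⟦ y ⟧}) , ⌊⌋-lower (∧ₚ-lowerʳ {R = ⟦ x ⟧}) ,
                 λ z z⊑x z⊑y → ⌊⌋-upper (∧ₚ-greatest (⊑⇒⊴ z⊑x) (⊑⇒⊴ z⊑y))

  ⊔-isJoin : ∀ x y → IsJoin x y (x ⊔ y)
  ⊔-isJoin x y = ⌊⌋-upper (∨ₚ-upperˡ {S = ⟦ y ⟧}) , ⌊⌋-upper (∨ₚ-upperʳ {R = ⟦ x ⟧}) ,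
                 λ z x⊑z y⊑z → ⌊⌋-lower (∨ₚ-least (⊑⇒⊴ x⊑z) (⊑⇒⊴ y⊑z))

  isLattice : IsLattice
  isLattice x y = (x ⊓ y , ⊓-isMeet x y) , (x ⊔ y , ⊔-isJoin x y)

  ⊏⇒linked : {x y : C⊥ n} → x ⊏ y → Linked⋆ ⟦ y ⟧
  ⊏⇒linked {y = bot}       (_ , y⋢x) = ⊥-elim (y⋢x tt)
  ⊏⇒linked {y = emb S π h} _         = ⟦emb⟧-linked S π h

  ⊏⇒separating-pair : {x y : C⊥ n} → x ⊏ y → ∃₂ λ a b →
    a ∼[ ⟦ y ⟧ ] b × ¬ a ∼[ ⟦ x ⟧ ] b × Linked⋆ (merge ⟦ x ⟧ a b)
  ⊏⇒separating-pair {bot} x⊏y =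
    let (k , ⋆∼k) = ⊏⇒linked x⊏y
    in ⋆ , suc k , ⋆∼k , (λ ()) , k , merge-relates {R = discrete} {⋆} {suc k}
  ⊏⇒separating-pair {emb S π h} (_ , y⋢x) =
    let (a , b , a∼b , a≁b) = ⋬⇒separating-pair (y⋢x ∘ ⊴⇒⊑)
        (k , ⋆∼k) = ⟦emb⟧-linked S π h
    in a , b , a∼b , a≁b , k , coarsen (merge-upper {R = ⟦ emb S π h ⟧} {a} {b}) {⋆} {suc k} ⋆∼k

  cover⇒merge : {m x : C⊥ n} → m ⋖ x →
    ∃₂ λ a b → ⟦ x ⟧ ⊴ merge ⟦ m ⟧ a b × merge ⟦ m ⟧ a b ⊴ ⟦ x ⟧
  cover⇒merge {m} {x} (m⊏x , nothing-between) with ⊏⇒separating-pair m⊏x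
  ... | a , b , a∼b , a≁b , linked = a , b , ⊴-trans (⊑⇒⊴ x⊑z) (⟦⌊⌋⟧⊴ M) , M⊴x
    where
    M = merge ⟦ m ⟧ a b
    M⊴x : M ⊴ ⟦ x ⟧
    M⊴x = merge-least (⊑⇒⊴ (proj₁ m⊏x)) a∼b
    z = ⌊ M ⌋
    m⊏z : m ⊏ z
    m⊏z = ⌊⌋-upper merge-upper ,
          λ z⊑m → a≁b (coarsen (⊑⇒⊴ z⊑m) (coarsen (⊴⟦⌊⌋⟧ linked) (merge-relates {R = ⟦ m ⟧})))
    x⊑z : x ⊑ z
    x⊑z = ⊑-stable λ x⋢z → nothing-between z (m⊏z , ⌊⌋-lower M⊴x , x⋢z)

  merge⇒cover : {x : C⊥ n} {c d : Fin (suc n)} → Linked⋆ (merge ⟦ x ⟧ c d) →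
                ¬ c ∼[ ⟦ x ⟧ ] d → x ⋖ ⌊ merge ⟦ x ⟧ c d ⌋
  merge⇒cover {x} {c} {d} linked c≁d = (⌊⌋-upper merge-upper , y⋢x) , nothing-between
    where
    M = merge ⟦ x ⟧ c d
    y = ⌊ M ⌋
    y⋢x : ¬ y ⊑ x
    y⋢x y⊑x = c≁d (coarsen (⊑⇒⊴ y⊑x) (coarsen (⊴⟦⌊⌋⟧ linked) (merge-relates {R = ⟦ x ⟧})))
    nothing-between : ∀ z → ¬ ((x ⊏ z) × (z ⊏ y))
    nothing-between z ((x⊑z , z⋢x) , (z⊑y , y⋢z)) =
      let (p , q , p∼q , p≁q) = ⋬⇒separating-pair (z⋢x ∘ ⊴⇒⊑)
          c∼d = merge-new-pair (⊑⇒⊴ x⊑z) (coarsen (⊴-trans (⊑⇒⊴ z⊑y) (⟦⌊⌋⟧⊴ M)) p∼q) p≁q p∼q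
      in y⋢z (⌊⌋-lower (merge-least (⊑⇒⊴ x⊑z) c∼d))

  ⋖-join : ∀ {x y m j} → IsMeet x y m → IsJoin x y j → m ⋖ x → m ⋖ y → x ⋖ j
  ⋖-join {x} {y} {m} {j} (m⊑x , _ , m-glb) (x⊑j , y⊑j , j-lub) m⋖x m⋖y
    with cover⇒merge m⋖y
  ... | c , d , y⊴M , M⊴y = ⋖-respʳ-≈ {_≤_ = _⊑_} ⊑-trans x⋖K (K⊑j , j⊑K)
    where
    c≁d : ¬ c ∼[ ⟦ x ⟧ ] d
    c≁d c∼d = proj₂ (proj₁ m⋖y)
      (m-glb y (⊴⇒⊑ (⊴-trans y⊴M (merge-least (⊑⇒⊴ m⊑x) c∼d))) ⊑-refl)
    linked : Linked⋆ (merge ⟦ x ⟧ c d)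
    linked = let (k , ⋆∼k) = ⊏⇒linked (proj₁ m⋖x) in k , coarsen (merge-upper {R = ⟦ x ⟧}) ⋆∼k
    K = ⌊ merge ⟦ x ⟧ c d ⌋
    x⋖K : x ⋖ K
    x⋖K = merge⇒cover linked c≁d
    K⊑j : K ⊑ j
    K⊑j = ⌊⌋-lower (merge-least (⊑⇒⊴ x⊑j)
            (coarsen (⊑⇒⊴ y⊑j) (coarsen M⊴y (merge-relates {R = ⟦ m ⟧}))))
    j⊑K : j ⊑ K
    j⊑K = j-lub K (proj₁ (proj₁ x⋖K))
            (⊴⇒⊑ (⊴-trans y⊴M (⊴-trans (merge-mono (⊑⇒⊴ m⊑x)) (⊴⟦⌊⌋⟧ linked))))

  upperSemimodular : UpperSemimodular
  upperSemimodular x y m j (m⊑x , m⊑y , m-glb) (x⊑j , y⊑j , j-lub) m⋖x m⋖y =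
    ⋖-join (m⊑x , m⊑y , m-glb) (x⊑j , y⊑j , j-lub) m⋖x m⋖y ,
    ⋖-join (m⊑y , m⊑x , λ z p q → m-glb z q p) (y⊑j , x⊑j , λ z p q → j-lub z q p) m⋖y m⋖x

module _ {n : ℕ} where
  open Order (_⊑_ {n}) renaming (_<_ to _⊏_)

  ⋢bot : {x : C⊥ n} → Linked⋆ ⟦ x ⟧ → ¬ x ⊑ bot
  ⋢bot (k , ⋆∼k) x⊑bot = contradiction (coarsen (⊑⇒⊴ x⊑bot) {⋆} {suc k} ⋆∼k) λ ()

  disjoint-⋆-blocks : {x y z : C⊥ n} →
    (∀ k → ⋆ ∼[ ⟦ x ⟧ ] suc k → ⋆ ∼[ ⟦ y ⟧ ] suc k → ⊥) → z ⊑ x → z ⊑ y → z ⊑ bot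
  disjoint-⋆-blocks {z = bot}       _        _   _   = tt
  disjoint-⋆-blocks {z = emb S π h} disjoint z⊑x z⊑y =
    let (k , ⋆∼k) = ⟦emb⟧-linked S π h
    in disjoint k (coarsen (⊑⇒⊴ z⊑x) ⋆∼k) (coarsen (⊑⇒⊴ z⊑y) ⋆∼k)

  -- opaque, so that concrete elements are not normalised during type checking
  opaque
    ⟨_⟩ : List (Fin (suc n) × Fin (suc n)) → C⊥ n
    ⟨ ps ⟩ = ⌊ mergeAll discrete ps ⌋

    ⟨⟩-least : {ps : List (Fin (suc n) × Fin (suc n))} {y : C⊥ n} →
               All (Edge ⟦ y ⟧) ps → ⟨ ps ⟩ ⊑ y
    ⟨⟩-least ps∼ = ⌊⌋-lower (mergeAll-least discrete-least ps∼)

    ⟨⟩-relates : (ps : List (Fin (suc n) × Fin (suc n))) {k : Fin n} {a b : Fin (suc n)} →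
                 (⋆ , suc k) ∈ˡ ps → (a , b) ∈ˡ ps → a ∼[ ⟦ ⟨ ps ⟩ ⟧ ] b
    ⟨⟩-relates ps ⋆k∈ ab∈ =
      coarsen (⊴⟦⌊⌋⟧ {R = mergeAll discrete ps} (_ , mergeAll-relates {R = discrete} ⋆k∈))
        (mergeAll-relates {R = discrete} ab∈)

    ⟨⟩-only : (ps : List (Fin (suc n) × Fin (suc n))) {a b : Fin (suc n)} →
              a ∼[ ⟦ ⟨ ps ⟩ ⟧ ] b → a ∼[ mergeAll discrete ps ] b
    ⟨⟩-only ps = coarsen (⟦⌊⌋⟧⊴ (mergeAll discrete ps))

  atom : Fin n → C⊥ n
  atom i = ⟨ (⋆ , suc i) ∷ [] ⟩

  ⋆∼atom : (i : Fin n) → ⋆ ∼[ ⟦ atom i ⟧ ] suc i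
  ⋆∼atom i = ⟨⟩-relates ((⋆ , suc i) ∷ []) (here refl) (here refl)

  ⋆∼atom⁻ : {i j : Fin n} → ⋆ ∼[ ⟦ atom i ⟧ ] suc j → j ≡ i
  ⋆∼atom⁻ {i} {j} ⋆∼j with merged⁻ discrete ⋆ (suc i) {⋆} {suc j} (⟨⟩-only ((⋆ , suc i) ∷ []) ⋆∼j)
  ... | a→b _ i∼j = sym (suc-injective (kernel⁻ _≟_ id i∼j))

  atom-least : {i : Fin n} {y : C⊥ n} → ⋆ ∼[ ⟦ y ⟧ ] suc i → atom i ⊑ y
  atom-least ⋆∼i = ⟨⟩-least (⋆∼i ∷ [])

  atom⋢bot : (i : Fin n) → ¬ atom i ⊑ bot
  atom⋢bot i = ⋢bot (i , ⋆∼atom i)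

  bot⋖atom : (i : Fin n) → bot ⋖ atom i
  bot⋖atom i = (tt , atom⋢bot i) , λ z ((_ , z⋢bot) , (z⊑i , i⋢z)) →
    let (k , ⋆∼k) = ⊏⇒linked (tt , z⋢bot)
        k≡i       = ⋆∼atom⁻ (coarsen (⊑⇒⊴ z⊑i) ⋆∼k)
    in i⋢z (atom-least (subst (λ k → ⋆ ∼[ ⟦ z ⟧ ] suc k) k≡i ⋆∼k))

  Atom⇒⊑atom : {a : C⊥ n} {k : Fin n} → Atom a → ⋆ ∼[ ⟦ a ⟧ ] suc k → a ⊑ atom k
  Atom⇒⊑atom {k = k} (_ , below-is-bottom) ⋆∼k =
    ⊑-stable λ a⋢k → atom⋢bot k (below-is-bottom (atom k) (atom-least ⋆∼k , a⋢k) bot)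

  top : C⊥ n
  top = ⌊ indiscrete ⌋

  top-isTop : IsTop top
  top-isTop y = ⌊⌋-upper indiscrete-greatest

  atoms-sup : IsSup (bot ⋖_) top
  atoms-sup = (λ y _ → top-isTop y) ,
              λ z atoms⊑z → ⌊⌋-lower (indiscrete-least ⋆ λ where
                ⋆       → ∼-refl ⟦ z ⟧
                (suc i) → coarsen (⊑⇒⊴ (atoms⊑z (atom i) (bot⋖atom i))) (⋆∼atom i))

module _ (k : ℕ) where
  private
    n : ℕ
    n = suc (suc (suc k))
  open Order (_⊑_ {n}) renaming (_<_ to _⊏_)

  p₀ p₁ p₂ : Fin (suc n)
  p₀ = suc zero
  p₁ = suc (suc zero)
  p₂ = suc (suc (suc zero))

  ⋆∼top : (q : Fin (suc n)) → ⋆ ∼[ ⟦ top ⟧ ] q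
  ⋆∼top q = coarsen (⊴⟦⌊⌋⟧ {R = indiscrete} (zero , refl)) {⋆} {q} refl

  coatom : Fin n → C⊥ n
  coatom i = ⌊ isolate (suc i) ⌋

  isolate-linked : (i : Fin n) → Linked⋆ (isolate (suc i))
  isolate-linked zero    = suc zero , isolate-∼ {suc n} {⋆} {p₀} {p₁} (λ ()) (λ ())
  isolate-linked (suc i) = zero , isolate-∼ {suc n} {⋆} {suc (suc i)} {p₀} (λ ()) (λ ())

  ⋆∼coatom : {i : Fin n} {q : Fin (suc n)} → q ≢ suc i → ⋆ ∼[ ⟦ coatom i ⟧ ] q
  ⋆∼coatom {i} {q} q≢i = coarsen (⊴⟦⌊⌋⟧ {R = isolate (suc i)} (isolate-linked i)) {⋆} {q}
    (isolate-∼ {a = ⋆} {c = suc i} (λ ()) q≢i)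

  ⋆≁coatom : (i : Fin n) → ¬ ⋆ ∼[ ⟦ coatom i ⟧ ] suc i
  ⋆≁coatom i =
    isolate-≁ {a = ⋆} {c = suc i} (λ ()) ∘ coarsen (⟦⌊⌋⟧⊴ (isolate (suc i))) {⋆} {suc i}

  coatom⋖top : (i : Fin n) → coatom i ⋖ top
  coatom⋖top i = (top-isTop _ , λ top⊑i → ⋆≁coatom i (coarsen (⊑⇒⊴ top⊑i) (⋆∼top (suc i)))) ,
    λ z ((i⊑z , z⋢i) , (_ , top⋢z)) →
      [ top⋢z ∘ ⌊⌋-lower , z⋢i ∘ ⌊⌋-upper ]′
        (isolate-or-indiscrete λ q q≢i → coarsen (⊑⇒⊴ i⊑z) (⋆∼coatom q≢i))

  coatoms-inf : IsInf (_⋖ top) bot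
  coatoms-inf = (λ _ _ → tt) , below-coatoms
    where
    below-coatoms : ∀ z → (∀ y → y ⋖ top → z ⊑ y) → z ⊑ bot
    below-coatoms bot         _          = tt
    below-coatoms (emb S π h) z⊑coatoms =
      let (i , ⋆∼i) = ⟦emb⟧-linked S π h
      in ⊥-elim (⋆≁coatom i (coarsen (⊑⇒⊴ (z⊑coatoms (coatom i) (coatom⋖top i))) ⋆∼i))

  bot-not-top : ¬ IsTop bot
  bot-not-top bot-top = atom⋢bot {n} zero (bot-top (atom zero))

  top-not-bot : ¬ IsBottom top
  top-not-bot top-bot = ⋢bot {n = n} {x = top} (zero , ⋆∼top (suc zero)) (top-bot bot)

  -- generating pairs; ⟨ ⋆2∣01 ⟩ has the blocks {⋆,2} and {0,1}, and so on
  ⋆01 ⋆2∣01 ⋆0∣12 : List (Fin (suc n) × Fin (suc n))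
  ⋆01   = (⋆ , p₀) ∷ (⋆ , p₁) ∷ []
  ⋆2∣01 = (⋆ , p₂) ∷ (p₀ , p₁) ∷ []
  ⋆0∣12 = (⋆ , p₀) ∷ (p₁ , p₂) ∷ []

  ⋆∼⟨⋆01⟩⁻ : ∀ {j} → ⋆ ∼[ ⟦ ⟨ ⋆01 ⟩ ⟧ ] suc j → j ≡ zero ⊎ j ≡ suc zero
  ⋆∼⟨⋆01⟩⁻ {j} h = go j (⟨⟩-only ⋆01 {⋆} {suc j} h)
    where
    go : ∀ j → ⋆ ∼[ mergeAll discrete ⋆01 ] suc j → j ≡ zero ⊎ j ≡ suc zero
    go zero                _  = inj₁ refl
    go (suc zero)          _  = inj₂ refl
    go (suc (suc zero))    ()
    go (suc (suc (suc j))) ()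

  ⋆∼⟨⋆2∣01⟩⁻ : ∀ {j} → ⋆ ∼[ ⟦ ⟨ ⋆2∣01 ⟩ ⟧ ] suc j → j ≡ suc (suc zero)
  ⋆∼⟨⋆2∣01⟩⁻ {j} h = go j (⟨⟩-only ⋆2∣01 {⋆} {suc j} h)
    where
    go : ∀ j → ⋆ ∼[ mergeAll discrete ⋆2∣01 ] suc j → j ≡ suc (suc zero)
    go zero                ()
    go (suc zero)          ()
    go (suc (suc zero))    _ = refl
    go (suc (suc (suc j))) ()

  ⋆∼⟨⋆0∣12⟩⁻ : ∀ {j} → ⋆ ∼[ ⟦ ⟨ ⋆0∣12 ⟩ ⟧ ] suc j → j ≡ zero
  ⋆∼⟨⋆0∣12⟩⁻ {j} h = go j (⟨⟩-only ⋆0∣12 {⋆} {suc j} h)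
    where
    go : ∀ j → ⋆ ∼[ mergeAll discrete ⋆0∣12 ] suc j → j ≡ zero
    go zero          _ = refl
    go (suc zero)    ()
    go (suc (suc j)) ()

  p₁≁p₂ : ¬ p₁ ∼[ ⟦ atom zero ⟧ ] p₂
  p₁≁p₂ h with ⟨⟩-only ((⋆ , p₀) ∷ []) {p₁} {p₂} h
  ... | ()

  not-modular : ¬ Modular
  not-modular modular = contradiction (⋆∼atom⁻ (coarsen (⊑⇒⊴ z⊑x) ⋆∼ᶻp₁)) λ ()
    where
    x = atom zero
    y = ⟨ ⋆2∣01 ⟩
    z = ⟨ ⋆01 ⟩
    ⋆∼ᶻp₁ : ⋆ ∼[ ⟦ z ⟧ ] p₁
    ⋆∼ᶻp₁ = ⟨⟩-relates ⋆01 (here refl) (there (here refl))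
    x⊑z : x ⊑ z
    x⊑z = atom-least (⟨⟩-relates ⋆01 (here refl) (here refl))
    y⊓z⊑bot : y ⊓ z ⊑ bot
    y⊓z⊑bot = disjoint-⋆-blocks {x = y} {y = z}
      (λ k ⋆∼ʸk ⋆∼ᶻk → case (⋆∼⟨⋆2∣01⟩⁻ ⋆∼ʸk) (⋆∼⟨⋆01⟩⁻ ⋆∼ᶻk))
      (proj₁ (⊓-isMeet y z)) (proj₁ (proj₂ (⊓-isMeet y z)))
      where
      case : ∀ {k : Fin n} → k ≡ suc (suc zero) → k ≡ zero ⊎ k ≡ suc zero → ⊥
      case refl (inj₁ ())
      case refl (inj₂ ())
    l⊑x : x ⊔ (y ⊓ z) ⊑ x
    l⊑x = proj₂ (proj₂ (⊔-isJoin x (y ⊓ z))) x ⊑-refl (⊑-trans y⊓z⊑bot tt)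
    z⊑x⊔y : z ⊑ x ⊔ y
    z⊑x⊔y = ⟨⟩-least (⋆∼p₀ ∷ ∼-trans ⟦ x ⊔ y ⟧ ⋆∼p₀ p₀∼p₁ ∷ [])
      where
      ⋆∼p₀ = coarsen (⊑⇒⊴ (proj₁ (⊔-isJoin x y))) (⋆∼atom zero)
      p₀∼p₁ = coarsen (⊑⇒⊴ (proj₁ (proj₂ (⊔-isJoin x y))))
                (⟨⟩-relates ⋆2∣01 (here refl) (there (here refl)))
    z⊑x : z ⊑ x
    z⊑x =
      let (_ , r⊑l) = modular x y z _ _ _ _ x⊑z (⊓-isMeet y z) (⊔-isJoin x (y ⊓ z))
                        (⊔-isJoin x y) (⊓-isMeet (x ⊔ y) z)
      in ⊑-trans (proj₂ (proj₂ (⊓-isMeet (x ⊔ y) z)) z z⊑x⊔y ⊑-refl) (⊑-trans r⊑l l⊑x)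

  not-distributive : ¬ Distributive
  not-distributive = not-modular ∘ distributive⇒modular ⊑-refl

  not-atomistic : ¬ Atomistic
  not-atomistic atomistic =
    let (L , L-atoms , L⊑x , x-least) = atomistic x
        x⊑atom₀ = x-least (atom zero) (All.zipWith atom⊑atom₀ (L-atoms , L⊑x))
    in p₁≁p₂ (coarsen (⊑⇒⊴ x⊑atom₀) (⟨⟩-relates ⋆0∣12 (here refl) (there (here refl))))
    where
    x = ⟨ ⋆0∣12 ⟩
    atom⊑atom₀ : ∀ {a} → Atom a × a ⊑ x → a ⊑ atom zero
    atom⊑atom₀ {bot}       ((a-not-bot , _) , _) = ⊥-elim (a-not-bot λ _ → tt)
    atom⊑atom₀ {emb S π h} (a-atom , a⊑x) =
      let (k , ⋆∼k) = ⟦emb⟧-linked S π h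
      in subst (λ k → emb S π h ⊑ atom k) (⋆∼⟨⋆0∣12⟩⁻ (coarsen (⊑⇒⊴ a⊑x) ⋆∼k))
           (Atom⇒⊑atom a-atom ⋆∼k)

  not-upperLocallyDistributive : ¬ LocalOrder.UpperLocallyDistributive (_⊑_ {n})
  not-upperLocallyDistributive uld = not-distributive
    (upperLocallyDistributive⇒distributive uld (λ _ → tt) bot-not-top top-isTop atoms-sup)

  not-lowerLocallyDistributive : ¬ LocalOrder.LowerLocallyDistributive (_⊑_ {n})
  not-lowerLocallyDistributive lld = not-distributive
    (lowerLocallyDistributive⇒distributive lld (λ _ → tt) top-isTop top-not-bot coatoms-inf)

proposition2 : (n : ℕ) → 2 < n →
    Order.IsLattice (_⊑_ {n}) ×
    ¬ Order.Distributive (_⊑_ {n}) ×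
    ¬ LocalOrder.UpperLocallyDistributive (_⊑_ {n}) ×
    ¬ LocalOrder.LowerLocallyDistributive (_⊑_ {n}) ×
    ¬ Order.Atomistic (_⊑_ {n}) ×
    ¬ Order.Geometric (_⊑_ {n}) ×
    ¬ Order.Modular (_⊑_ {n}) ×
    Order.UpperSemimodular (_⊑_ {n})
proposition2 (suc (suc (suc k))) (s≤s (s≤s (s≤s _))) =
  isLattice , not-distributive k , not-upperLocallyDistributive k ,
  not-lowerLocallyDistributive k , not-atomistic k , not-atomistic k ∘ proj₁ ,
  not-modular k , upperSemimodular
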